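{- Let $(A,A^{W},\Vdash^{A},\ell^{A})$ be a graph with complementarity and let $p\colon G\to A$ be a morphism of reflexive graphs. Let $G^{W}$ be the subgraph of $G$ of vertices and edges mapped by $p$ into $A^{W}$, let $\ell^{G}=\ell^{A}\circ p$ restricted to $G^{W}$, and let $\Vdash^{G}$ be the relation defined, on vertices and on edges, by $(x,y)\Vdash^{G} z$ iff $z\in G^{W}$ and $(p(x),p(y))\Vdash^{A} p(z)$. Suppose given, for all vertices $x,y$ of $G$ and vertices $a$ of $A$ with $(p(x),p(y))\Vdash^{A} a$, a vertex $[x,y]_a$ of $G$ with $p([x,y]_a)=a$, such that for all edges $e_x\colon x'\to x$ and $e_y\colon y'\to y$ of $G$ and $e_a\colon a'\to a$ of $A$ with $(p(e_x),p(e_y))\Vdash^{A} e_a$, there exists an edge $[e_x,e_y]_{e_a}\colon [x',y']_{a'}\to[x,y]_a$ in $G$ with $p([e_x,e_y]_{e_a})=e_a$. Then $(G,G^{W},\Vdash^{G},\ell^{G})$ is a graph with complementarity and $p$ is a morphism of graphs with complementarity.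
   Context: A reflexive graph consists of vertices, edges, source and target maps, and an identity edge $\mathit{id}_x\colon x\to x$ for each vertex; morphisms preserve all of these. Products, pullbacks and subgraphs are componentwise. A relation $R\colon G\nrightarrow H$ between reflexive graphs is a subgraph of $G\times H$; it is partially functional if every vertex (resp. edge) of $G$ is related to at most one vertex (resp. edge) of $H$; its domain is the subgraph of $G$ of elements related to something. $\Sigma$ is the reflexive graph with a single vertex whose edges are the identity $\mathit{id}$ and one loop $\heartsuit$. A graph with complementarity is a tuple $(A,A^{W},\Vdash^{A},\ell^{A})$ with $A$ a reflexive graph, $A^{W}$ a subgraph, $\Vdash^{A}\colon A\times A\nrightarrow A^{W}$ a relation, and $\ell^{A}\colon A^{W}\to\Sigma$ a morphism of reflexive graphs, such that the composite relation $A\times A\nrightarrow A^{W}\to\Sigma$ is partially functional and symmetric (relates $(a,b)$ to $\sigma$ iff it relates $(b,a)$ to $\sigma$). A morphism of graphs with complementarity $f\colon A\to B$ is a morphism of reflexive graphs with $f(A^{W})\subseteq B^{W}$, $\ell^{B}\circ f=\ell^{A}$ on $A^{W}$, and $(a_1,a_2)\Vdash^{A}a_3\Rightarrow(f(a_1),f(a_2))\Vdash^{B}f(a_3)$. -}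

module Defs where

open import Data.Product using (Σ; _×_; _,_; proj₁; proj₂)
open import Data.Unit using (⊤; tt)
open import Relation.Binary.PropositionalEquality
  using (_≡_; refl; subst; cong; cong₂; sym; trans)

record RGraph : Set₁ where
  field
    V   : Set
    E   : Set
    src : E → V
    tgt : E → V
    idE : V → E
    src-id : ∀ x → src (idE x) ≡ x
    tgt-id : ∀ x → tgt (idE x) ≡ x
open RGraph public

record Hom (G H : RGraph) : Set where
  field
    fV : V G → V H
    fE : E G → E H
    src-comm : ∀ e → src H (fE e) ≡ fV (src G e)
    tgt-comm : ∀ e → tgt H (fE e) ≡ fV (tgt G e)
    id-comm  : ∀ x → idE H (fV x) ≡ fE (idE G x)
open Hom public

_∘H_ : {G H K : RGraph} → Hom H K → Hom G H → Hom G K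
_∘H_ {G} {H} {K} g f = record
  { fV = λ x → fV g (fV f x)
  ; fE = λ e → fE g (fE f e)
  ; src-comm = λ e → trans (src-comm g (fE f e)) (cong (fV g) (src-comm f e))
  ; tgt-comm = λ e → trans (tgt-comm g (fE f e)) (cong (fV g) (tgt-comm f e))
  ; id-comm  = λ x → trans (id-comm g (fV f x)) (cong (fE g) (id-comm f x))
  }

_⊗_ : RGraph → RGraph → RGraph
G ⊗ H = record
  { V = V G × V H
  ; E = E G × E H
  ; src = λ { (e , e') → src G e , src H e' }
  ; tgt = λ { (e , e') → tgt G e , tgt H e' }
  ; idE = λ { (x , x') → idE G x , idE H x' }
  ; src-id = λ { (x , x') → cong₂ _,_ (src-id G x) (src-id H x') }
  ; tgt-id = λ { (x , x') → cong₂ _,_ (tgt-id G x) (tgt-id H x') }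
  }

_⊗H_ : {G G' H H' : RGraph} → Hom G H → Hom G' H' → Hom (G ⊗ G') (H ⊗ H')
f ⊗H g = record
  { fV = λ { (x , y) → fV f x , fV g y }
  ; fE = λ { (e , e') → fE f e , fE g e' }
  ; src-comm = λ { (e , e') → cong₂ _,_ (src-comm f e) (src-comm g e') }
  ; tgt-comm = λ { (e , e') → cong₂ _,_ (tgt-comm f e) (tgt-comm g e') }
  ; id-comm  = λ { (x , y) → cong₂ _,_ (id-comm f x) (id-comm g y) }
  }

IsProp : Set → Set
IsProp A = (a b : A) → a ≡ b

record Subgraph (G : RGraph) : Set₁ where
  field
    inV : V G → Set
    inE : E G → Set
    inV-prop : ∀ x → IsProp (inV x)
    inE-prop : ∀ e → IsProp (inE e)
    src-closed : ∀ {e} → inE e → inV (src G e)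
    tgt-closed : ∀ {e} → inE e → inV (tgt G e)
    id-closed  : ∀ {x} → inV x → inE (idE G x)
open Subgraph public

private
  Σ-≡ : {A : Set} {P : A → Set} → (∀ x → IsProp (P x)) →
        {x y : A} {a : P x} {b : P y} → x ≡ y → (x , a) ≡ (y , b)
  Σ-≡ prop {x} {a = a} {b} refl = cong (x ,_) (prop x a b)

⟪_⟫ : {G : RGraph} → Subgraph G → RGraph
⟪_⟫ {G} S = record
  { V = Σ (V G) (inV S)
  ; E = Σ (E G) (inE S)
  ; src = λ { (e , w) → src G e , src-closed S w }
  ; tgt = λ { (e , w) → tgt G e , tgt-closed S w }
  ; idE = λ { (x , w) → idE G x , id-closed S w }
  ; src-id = λ { (x , w) → Σ-≡ (inV-prop S) (src-id G x) }
  ; tgt-id = λ { (x , w) → Σ-≡ (inV-prop S) (tgt-id G x) }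
  }

preimage : {H K : RGraph} → Subgraph K → Hom H K → Subgraph H
preimage {H} {K} S f = record
  { inV = λ x → inV S (fV f x)
  ; inE = λ e → inE S (fE f e)
  ; inV-prop = λ x → inV-prop S (fV f x)
  ; inE-prop = λ e → inE-prop S (fE f e)
  ; src-closed = λ {e} w → subst (inV S) (src-comm f e) (src-closed S w)
  ; tgt-closed = λ {e} w → subst (inV S) (tgt-comm f e) (tgt-closed S w)
  ; id-closed  = λ {x} w → subst (inE S) (id-comm f x) (id-closed S w)
  }

restrict : {H K : RGraph} (S : Subgraph K) (f : Hom H K) →
           Hom ⟪ preimage S f ⟫ ⟪ S ⟫
restrict S f = record
  { fV = λ { (x , w) → fV f x , w }
  ; fE = λ { (e , w) → fE f e , w }
  ; src-comm = λ { (e , w) → Σ-≡ (inV-prop S) (src-comm f e) }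
  ; tgt-comm = λ { (e , w) → Σ-≡ (inV-prop S) (tgt-comm f e) }
  ; id-comm  = λ { (x , w) → Σ-≡ (inE-prop S) (id-comm f x) }
  }

Relation : RGraph → RGraph → Set₁
Relation G H = Subgraph (G ⊗ H)

data ΣEdge : Set where
  idΣ : ΣEdge
  ♥   : ΣEdge

ΣG : RGraph
ΣG = record
  { V = ⊤ ; E = ΣEdge
  ; src = λ _ → tt ; tgt = λ _ → tt ; idE = λ _ → idΣ
  ; src-id = λ _ → refl ; tgt-id = λ _ → refl }

-- composite relation  R ; f  : G ⇸ K  of a relation R : G ⇸ H with f : H → K
compV : {G H K : RGraph} → Relation G H → Hom H K → V G → V K → Set
compV {H = H} R f g k = Σ (V H) λ h → inV R (g , h) × fV f h ≡ k

compE : {G H K : RGraph} → Relation G H → Hom H K → E G → E K → Set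
compE {H = H} R f g k = Σ (E H) λ h → inE R (g , h) × fE f h ≡ k

record IsGraphWithComp (A : RGraph) (AW : Subgraph A)
       (⊩ : Relation (A ⊗ A) ⟪ AW ⟫) (ℓ : Hom ⟪ AW ⟫ ΣG) : Set where
  field
    pfunV : ∀ (ab : V (A ⊗ A)) (σ σ' : V ΣG) →
            compV ⊩ ℓ ab σ → compV ⊩ ℓ ab σ' → σ ≡ σ'
    pfunE : ∀ (ab : E (A ⊗ A)) (σ σ' : E ΣG) →
            compE ⊩ ℓ ab σ → compE ⊩ ℓ ab σ' → σ ≡ σ'
    symV : ∀ (a b : V A) (σ : V ΣG) → compV ⊩ ℓ (a , b) σ → compV ⊩ ℓ (b , a) σ
    symE : ∀ (a b : E A) (σ : E ΣG) → compE ⊩ ℓ (a , b) σ → compE ⊩ ℓ (b , a) σ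

record GraphWithComp : Set₁ where
  field
    A   : RGraph
    AW  : Subgraph A
    ⊩   : Relation (A ⊗ A) ⟪ AW ⟫
    ℓ   : Hom ⟪ AW ⟫ ΣG
    isGWC : IsGraphWithComp A AW ⊩ ℓ

module _ where
  open GraphWithComp

  record IsGWCMorphism (𝒜 ℬ : GraphWithComp) (f : Hom (A 𝒜) (A ℬ)) : Set where
    field
      WV : ∀ {x} → inV (AW 𝒜) x → inV (AW ℬ) (fV f x)
      WE : ∀ {e} → inE (AW 𝒜) e → inE (AW ℬ) (fE f e)
      ℓV : ∀ x (w : inV (AW 𝒜) x) → fV (ℓ ℬ) (fV f x , WV w) ≡ fV (ℓ 𝒜) (x , w)
      ℓE : ∀ e (w : inE (AW 𝒜) e) → fE (ℓ ℬ) (fE f e , WE w) ≡ fE (ℓ 𝒜) (e , w)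
      ⊩V : ∀ a₁ a₂ a₃ (w : inV (AW 𝒜) a₃) → inV (⊩ 𝒜) ((a₁ , a₂) , (a₃ , w)) →
           inV (⊩ ℬ) ((fV f a₁ , fV f a₂) , (fV f a₃ , WV w))
      ⊩E : ∀ a₁ a₂ a₃ (w : inE (AW 𝒜) a₃) → inE (⊩ 𝒜) ((a₁ , a₂) , (a₃ , w)) →
           inE (⊩ ℬ) ((fE f a₁ , fE f a₂) , (fE f a₃ , WE w))

module Induced (𝒜 : GraphWithComp) {G : RGraph}
               (p : Hom G (GraphWithComp.A 𝒜)) where
  open GraphWithComp 𝒜

  GW : Subgraph G
  GW = preimage AW p

  ℓG : Hom ⟪ GW ⟫ ΣG
  ℓG = ℓ ∘H restrict AW p

  ⊩G : Relation (G ⊗ G) ⟪ GW ⟫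
  ⊩G = preimage ⊩ ((p ⊗H p) ⊗H restrict AW p)

  induced : IsGraphWithComp G GW ⊩G ℓG → GraphWithComp
  induced isG = record { A = G ; AW = GW ; ⊩ = ⊩G ; ℓ = ℓG ; isGWC = isG }

module Submission where

-- Everything about the induced structure (G^W, ⊩^G, ℓ^G) is defined by
-- pulling back along p, so a witness of the composite relation
-- ⊩^G ; ℓ^G over (x , y) is literally a witness of ⊩^A ; ℓ^A over
-- (p x , p y) whose middle element happens to be of the form p z.  This
-- gives two facts: witnesses can always be PUSHED from G to A, and a witness
-- in A can be LIFTED to G as soon as its middle element has a preimage.
-- Partial functionality of ⊩^G ; ℓ^G follows from that of A by pushing.
-- Symmetry follows by pushing, applying symmetry in A, and lifting back;
-- the needed preimage is the bracket [y , x]_a on vertices and the edge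
-- bracket on edges, whose endpoints are the brackets of the endpoints.
-- Finally p is a morphism because the induced structure is the preimage.

open import Defs
open import Data.Product using (Σ; _×_; _,_; proj₁)
open import Relation.Binary.PropositionalEquality using (_≡_; refl; subst; cong₂)
open GraphWithComp using (A; AW; ⊩; ℓ; isGWC)

module _ {G H K : RGraph} (R : Relation (H ⊗ H) K) (p : Hom G H) where

  related-tgt : ∀ {ex ey : E G} {k : E K} →
    inE R ((fE p ex , fE p ey) , k) →
    inV R ((fV p (tgt G ex) , fV p (tgt G ey)) , tgt K k)
  related-tgt {ex} {ey} {k} r =
    subst (λ xy → inV R (xy , tgt K k))
          (cong₂ _,_ (tgt-comm p ex) (tgt-comm p ey)) (tgt-closed R r)

  related-src : ∀ {ex ey : E G} {k : E K} →
    inE R ((fE p ex , fE p ey) , k) →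
    inV R ((fV p (src G ex) , fV p (src G ey)) , src K k)
  related-src {ex} {ey} {k} r =
    subst (λ xy → inV R (xy , src K k))
          (cong₂ _,_ (src-comm p ex) (src-comm p ey)) (src-closed R r)

module InducedFacts (𝒜 : GraphWithComp) {G : RGraph} (p : Hom G (A 𝒜)) where
  open Induced 𝒜 p
  open IsGraphWithComp (isGWC 𝒜)

  Aᵂ : RGraph
  Aᵂ = ⟪ AW 𝒜 ⟫

  VertexBrackets : Set
  VertexBrackets = (x y : V G) (a : V Aᵂ) → inV (⊩ 𝒜) ((fV p x , fV p y) , a) → V G

  LiesOver : VertexBrackets → Set
  LiesOver br = ∀ x y a r → fV p (br x y a r) ≡ proj₁ a

  EdgeBrackets : VertexBrackets → Set
  EdgeBrackets br =
    ∀ (x x' y y' : V G) (a a' : V Aᵂ)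
      (r : inV (⊩ 𝒜) ((fV p x , fV p y) , a))
      (r' : inV (⊩ 𝒜) ((fV p x' , fV p y') , a'))
      (ex ey : E G) (ea : E Aᵂ) →
      src G ex ≡ x' → tgt G ex ≡ x →
      src G ey ≡ y' → tgt G ey ≡ y →
      src Aᵂ ea ≡ a' → tgt Aᵂ ea ≡ a →
      inE (⊩ 𝒜) ((fE p ex , fE p ey) , ea) →
      Σ (E G) λ e → (src G e ≡ br x' y' a' r') × (tgt G e ≡ br x y a r)
                    × (fE p e ≡ proj₁ ea)

  pushV : ∀ {x y σ} → compV ⊩G ℓG (x , y) σ →
          compV (⊩ 𝒜) (ℓ 𝒜) (fV p x , fV p y) σ
  pushV ((z , w) , r , q) = (fV p z , w) , r , q

  pushE : ∀ {ex ey σ} → compE ⊩G ℓG (ex , ey) σ →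
          compE (⊩ 𝒜) (ℓ 𝒜) (fE p ex , fE p ey) σ
  pushE ((e , w) , r , q) = (fE p e , w) , r , q

  liftV : ∀ {x y σ} (h : V Aᵂ) → inV (⊩ 𝒜) ((fV p x , fV p y) , h) →
          fV (ℓ 𝒜) h ≡ σ → (z : V G) → fV p z ≡ proj₁ h →
          compV ⊩G ℓG (x , y) σ
  liftV (.(fV p z) , w) r q z refl = (z , w) , r , q

  liftE : ∀ {ex ey σ} (h : E Aᵂ) → inE (⊩ 𝒜) ((fE p ex , fE p ey) , h) →
          fE (ℓ 𝒜) h ≡ σ → (e : E G) → fE p e ≡ proj₁ h →
          compE ⊩G ℓG (ex , ey) σ
  liftE (.(fE p e) , w) r q e refl = (e , w) , r , q

  induced-pfunV : ∀ xy (σ σ' : V ΣG) →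
    compV ⊩G ℓG xy σ → compV ⊩G ℓG xy σ' → σ ≡ σ'
  induced-pfunV (x , y) σ σ' c c' = pfunV (fV p x , fV p y) σ σ' (pushV c) (pushV c')

  induced-pfunE : ∀ exy (σ σ' : E ΣG) →
    compE ⊩G ℓG exy σ → compE ⊩G ℓG exy σ' → σ ≡ σ'
  induced-pfunE (ex , ey) σ σ' c c' = pfunE (fE p ex , fE p ey) σ σ' (pushE c) (pushE c')

  induced-symV : (br : VertexBrackets) → LiesOver br →
    ∀ x y σ → compV ⊩G ℓG (x , y) σ → compV ⊩G ℓG (y , x) σ
  induced-symV br over x y σ c with symV (fV p x) (fV p y) σ (pushV c)
  ... | h , r , q = liftV h r q (br y x h r) (over y x h r)

  -- Symmetry on edges: the swapped witness h lifts to the edge bracket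
  -- [ey , ex]_h between the brackets at the endpoints.
  induced-symE : (br : VertexBrackets) → EdgeBrackets br →
    ∀ ex ey σ → compE ⊩G ℓG (ex , ey) σ → compE ⊩G ℓG (ey , ex) σ
  induced-symE br edgeBr ex ey σ c with symE (fE p ex) (fE p ey) σ (pushE c)
  ... | h , r , q
      with edgeBr (tgt G ey) (src G ey) (tgt G ex) (src G ex)
                  (tgt Aᵂ h) (src Aᵂ h)
                  (related-tgt (⊩ 𝒜) p r) (related-src (⊩ 𝒜) p r)
                  ey ex h refl refl refl refl refl refl r
  ... | e , _ , _ , over = liftE h r q e over

  p-isGWCMorphism : (isG : IsGraphWithComp G GW ⊩G ℓG) →
                    IsGWCMorphism (induced isG) 𝒜 p
  p-isGWCMorphism isG = record
    { WV = λ w → w ; WE = λ w → w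
    ; ℓV = λ _ _ → refl ; ℓE = λ _ _ → refl
    ; ⊩V = λ _ _ _ _ r → r ; ⊩E = λ _ _ _ _ r → r }

proposition6p12 :
    (𝒜 : GraphWithComp) (G : RGraph) (p : Hom G (A 𝒜)) →
    (br : (x y : V G) (a : V ⟪ AW 𝒜 ⟫) →
          inV (⊩ 𝒜) ((fV p x , fV p y) , a) → V G) →
    (∀ x y a r → fV p (br x y a r) ≡ proj₁ a) →
    (∀ (x x' y y' : V G) (a a' : V ⟪ AW 𝒜 ⟫)
       (r : inV (⊩ 𝒜) ((fV p x , fV p y) , a))
       (r' : inV (⊩ 𝒜) ((fV p x' , fV p y') , a'))
       (ex ey : E G) (ea : E ⟪ AW 𝒜 ⟫) →
       src G ex ≡ x' → tgt G ex ≡ x →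
       src G ey ≡ y' → tgt G ey ≡ y →
       src ⟪ AW 𝒜 ⟫ ea ≡ a' → tgt ⟪ AW 𝒜 ⟫ ea ≡ a →
       inE (⊩ 𝒜) ((fE p ex , fE p ey) , ea) →
       Σ (E G) λ e → (src G e ≡ br x' y' a' r') × (tgt G e ≡ br x y a r)
                     × (fE p e ≡ proj₁ ea)) →
    Σ (IsGraphWithComp G (Induced.GW 𝒜 p) (Induced.⊩G 𝒜 p) (Induced.ℓG 𝒜 p))
      λ isG → IsGWCMorphism (Induced.induced 𝒜 p isG) 𝒜 p
proposition6p12 𝒜 G p br over edgeBr = isG , p-isGWCMorphism isG
  where
  open InducedFacts 𝒜 p
  isG : IsGraphWithComp G (Induced.GW 𝒜 p) (Induced.⊩G 𝒜 p) (Induced.ℓG 𝒜 p)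
  isG = record
    { pfunV = induced-pfunV
    ; pfunE = induced-pfunE
    ; symV  = induced-symV br over
    ; symE  = induced-symE br edgeBr
    }
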